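{- Let $S=\{R_0,\dots,R_d\}$ be an association scheme and let $T$ be a singular subset of $S$. Then $T$ is a closed subset of $S$ if and only if $R_{i^*}R_j\subseteq T$ for all $0\le i\ne j\le d$ with $R_i,R_j\in T$.
   Context: $S$ is an association scheme on a finite set $X$ with relations $R_0$ (diagonal), $R_1,\dots,R_d$, transposes $R_{i^*}$, intersection numbers $p_{ij}^k$ and valencies $k_i=p_{ii^*}^0$. For nonempty $U,V\subseteq S$, $UV=\{R_k:\exists R_u\in U,R_v\in V,\ p_{uv}^k>0\}$ (associative; $R_i$ stands for $\{R_i\}$). $T\subseteq S$ nonempty is closed if $T^*T\subseteq T$, $T^*=\{R_{i^*}:R_i\in T\}$. $O_\vartheta(S)=\{R_i:k_i=1\}$. A subset $T\subseteq S$ is singular if (i) $O_\vartheta(S)\subseteq T$ and (ii) $R_xR_{y^*}R_yR_z\subseteq T$ for all $R_x\in O_\vartheta(S)$, $R_y\in S$, $R_z\in T$. -}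

module Defs where

open import Level using (0ℓ)
open import Data.Nat using (ℕ; suc; _>_)
open import Data.Fin using (Fin; zero; _≟_)
open import Data.List using (List; length; filter; allFin)
open import Data.Product using (Σ; ∃; ∃-syntax; _×_; _,_)
open import Relation.Nullary using (¬_)
open import Relation.Nullary.Decidable using (_×-dec_)
open import Relation.Binary.PropositionalEquality using (_≡_)
open import Relation.Unary using (Pred; _⊆_)

-- An association scheme on the finite set X = Fin n with relations
-- R_0, ..., R_d, given by the map rel : X → X → Fin (suc d) sending (x,y)
-- to the index i with (x,y) ∈ R_i (so the R_i partition X × X).
record AssocScheme : Set where
  field
    n d    : ℕ
    rel    : Fin n → Fin n → Fin (suc d)
    diag₁  : ∀ x → rel x x ≡ zero
    diag₂  : ∀ x y → rel x y ≡ zero → x ≡ y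
    nonempty : ∀ i → ∃[ x ] ∃[ y ] rel x y ≡ i
    -- transposes: R_i^T = R_{i*}
    tr     : Fin (suc d) → Fin (suc d)
    rel-tr : ∀ x y → rel y x ≡ tr (rel x y)
    p      : Fin (suc d) → Fin (suc d) → Fin (suc d) → ℕ
    p-count : ∀ i j x y →
      length (filter (λ z → (rel x z ≟ i) ×-dec (rel z y ≟ j)) (allFin n))
        ≡ p i j (rel x y)

module _ (S : AssocScheme) where
  open AssocScheme S

  Rels : Set₁
  Rels = Pred (Fin (suc d)) 0ℓ

  ⟦_⟧ : Fin (suc d) → Rels
  ⟦ i ⟧ k = k ≡ i

  _·_ : Rels → Rels → Rels
  (U · V) k = ∃[ u ] ∃[ v ] (U u × V v × p u v k > 0)

  _* : Rels → Rels
  (U *) k = ∃[ i ] (U i × k ≡ tr i)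

  valency : Fin (suc d) → ℕ
  valency i = p i (tr i) zero

  Oθ : Rels
  Oθ i = valency i ≡ 1

  IsClosed : Rels → Set
  IsClosed T = (∃[ i ] T i) × (((T *) · T) ⊆ T)

  IsSingular : Rels → Set
  IsSingular T = (Oθ ⊆ T)
    × (∀ x y z → Oθ x → T z →
         (((⟦ x ⟧ · ⟦ tr y ⟧) · ⟦ y ⟧) · ⟦ z ⟧) ⊆ T)

-- Closedness asks that R_{i*} R_j ⊆ T for all R_i, R_j ∈ T, so only the
-- diagonal products R_{i*} R_i are at stake. For these, R_0 has valency 1 and
-- lies in T, and R_{i*} R_i ⊆ R_0 R_{i*} R_i R_0, which a singular T contains.
module Submission where

open import Defs
open import Data.Fin using (zero; _≟_)
open import Data.Nat using (_>_)
open import Data.List using (List; []; _∷_; length; filter; allFin)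
open import Data.List.Properties using (filter-some)
open import Data.List.Membership.Propositional using (_∈_)
open import Data.List.Membership.Propositional.Properties using (∈-allFin; ∈-filter⁺; ∈-filter⁻)
open import Data.List.Relation.Unary.Any using (here; there) renaming (map to any-map)
open import Data.List.Relation.Unary.AllPairs using (_∷_)
open import Data.List.Relation.Unary.All using (_∷_)
open import Data.List.Relation.Unary.Unique.Propositional using (Unique)
open import Data.List.Relation.Unary.Unique.Propositional.Properties using (allFin⁺; filter⁺)
open import Data.Product using (_×_; _,_; proj₁; proj₂)
open import Data.Empty using (⊥-elim)
open import Level using (0ℓ)
open import Relation.Nullary using (¬_; yes; no)
open import Relation.Nullary.Decidable using (_×-dec_)
open import Relation.Binary.PropositionalEquality using (_≡_; refl; sym; trans; cong; subst)
open import Relation.Unary using (Pred; Decidable; _⊆_)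

length≡1 : ∀ {A : Set} {x : A} {ys : List A} →
           Unique ys → x ∈ ys → (∀ {z} → z ∈ ys → z ≡ x) → length ys ≡ 1
length≡1 {ys = _ ∷ []}    _                 _ _    = refl
length≡1 {ys = _ ∷ _ ∷ _} ((y≢z ∷ _) ∷ _) _ all≡x =
  ⊥-elim (y≢z (trans (all≡x (here refl)) (sym (all≡x (there (here refl))))))

length-filter-unique : ∀ {A : Set} {P : Pred A 0ℓ} (P? : Decidable P) {x : A} {xs : List A} →
                       Unique xs → x ∈ xs → P x → (∀ {z} → P z → z ≡ x) →
                       length (filter P? xs) ≡ 1
length-filter-unique P? {xs = xs} uniq x∈xs px only-x =
  length≡1 (filter⁺ P? uniq) (∈-filter⁺ P? x∈xs px) (λ z∈ → only-x (proj₂ (∈-filter⁻ P? {xs = xs} z∈)))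

module _ (S : AssocScheme) where
  open AssocScheme S

  p-rel-pos : ∀ {x y z} → p (rel x z) (rel z y) (rel x y) > 0
  p-rel-pos {x} {y} {z} = subst (_> 0) (p-count (rel x z) (rel z y) x y)
    (filter-some (λ w → (rel x w ≟ rel x z) ×-dec (rel w y ≟ rel z y))
                 (any-map (λ { refl → refl , refl }) (∈-allFin z)))

  tr-zero : tr zero ≡ zero
  tr-zero with nonempty zero
  ... | x , _ , _ = trans (cong tr (sym (diag₁ x))) (trans (sym (rel-tr x x)) (diag₁ x))

  p-zero-left-pos : ∀ a → p zero a a > 0
  p-zero-left-pos a with nonempty a
  ... | x , y , refl = subst (λ i → p i (rel x y) (rel x y) > 0) (diag₁ x) (p-rel-pos {x} {y} {x})

  p-zero-right-pos : ∀ a → p a zero a > 0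
  p-zero-right-pos a with nonempty a
  ... | x , y , refl = subst (λ j → p (rel x y) j (rel x y) > 0) (diag₁ y) (p-rel-pos {x} {y} {y})

  valency-zero : valency S zero ≡ 1
  valency-zero with nonempty zero
  ... | x , _ , _ =
    subst (λ k → p zero (tr zero) k ≡ 1) (diag₁ x)
      (trans (sym (p-count zero (tr zero) x x))
        (length-filter-unique (λ z → (rel x z ≟ zero) ×-dec (rel z x ≟ tr zero))
          (allFin⁺ n) (∈-allFin x)
          (diag₁ x , trans (diag₁ x) (sym tr-zero))
          (λ rel≡ → sym (diag₂ x _ (proj₁ rel≡)))))

  singular-zero : ∀ {T : Rels S} → IsSingular S T → T zero
  singular-zero (Oθ⊆T , _) = Oθ⊆T valency-zero

  singular-tr-product-self⊆ : ∀ {T : Rels S} → IsSingular S T →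
                              ∀ i → _·_ S (⟦_⟧ S (tr i)) (⟦_⟧ S i) ⊆ T
  singular-tr-product-self⊆ singular@(_ , absorbs) i {k} (_ , _ , refl , refl , pos) =
    absorbs zero i zero valency-zero (singular-zero singular)
      (k , zero , (tr i , i , (zero , tr i , refl , refl , p-zero-left-pos (tr i)) , refl , pos)
                , refl , p-zero-right-pos k)

  closed⇒tr-product⊆ : ∀ {T : Rels S} → IsClosed S T →
                       ∀ {i j} → T i → T j → _·_ S (⟦_⟧ S (tr i)) (⟦_⟧ S j) ⊆ T
  closed⇒tr-product⊆ (_ , closed) {i} ti tj (_ , _ , refl , refl , pos) =
    closed (tr i , _ , (i , ti , refl) , tj , pos)

  tr-product⊆⇒closed : ∀ {T : Rels S} → T zero →
                       (∀ {i j} → T i → T j → _·_ S (⟦_⟧ S (tr i)) (⟦_⟧ S j) ⊆ T) → IsClosed S T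
  tr-product⊆⇒closed t0 products⊆ =
    (zero , t0) , λ { (_ , _ , (i , ti , refl) , tj , pos) → products⊆ ti tj (_ , _ , refl , refl , pos) }

proposition3p6 : (S : AssocScheme) (T : Rels S) → IsSingular S T →
    (IsClosed S T → ∀ i j → ¬ (i ≡ j) → T i → T j → _·_ S (⟦_⟧ S (AssocScheme.tr S i)) (⟦_⟧ S j) ⊆ T)
    × ((∀ i j → ¬ (i ≡ j) → T i → T j → _·_ S (⟦_⟧ S (AssocScheme.tr S i)) (⟦_⟧ S j) ⊆ T) → IsClosed S T)
proposition3p6 S T singular =
    (λ closed _ _ _ → closed⇒tr-product⊆ S closed)
  , (λ off-diagonal⊆ → tr-product⊆⇒closed S (singular-zero S singular) (products⊆ off-diagonal⊆))
  where
  products⊆ : (∀ i j → ¬ (i ≡ j) → T i → T j → _·_ S (⟦_⟧ S (AssocScheme.tr S i)) (⟦_⟧ S j) ⊆ T) →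
              ∀ {i j} → T i → T j → _·_ S (⟦_⟧ S (AssocScheme.tr S i)) (⟦_⟧ S j) ⊆ T
  products⊆ off-diagonal⊆ {i} {j} ti tj with i ≟ j
  ... | yes refl = singular-tr-product-self⊆ S singular i
  ... | no i≢j   = off-diagonal⊆ i j i≢j ti tj
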